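{- There exists a set $A\subseteq\mathbb{Z}^d$ which is additively $\mathrm{IP}^*$ but such that $A\setminus\{0\}$ is not syndetic in the semigroup $(\mathbb{Z}^d_{\neq0},\circledast)$ for any proper multiplication $\circledast$ on $\mathbb{Z}^d$.
   Context: A proper multiplication on $\mathbb{Z}^d$ is a binary operation $\circledast:\mathbb{Z}^d\times\mathbb{Z}^d\to\mathbb{Z}^d$ making $(\mathbb{Z}^d,+)$ an associative (not necessarily commutative or unital) ring without zero divisors; $\mathbb{Z}^d_{\neq0}=\mathbb{Z}^d\setminus\{0\}$. A subset of $\mathbb{Z}^d$ is additively $\mathrm{IP}$ if it contains $\{\sum_{i\in I}x_i: I\subseteq\mathbb{N}\text{ finite non-empty}\}$ for some sequence $(x_n)_{n\in\mathbb{N}}$ in $\mathbb{Z}^d$; it is additively $\mathrm{IP}^*$ if it meets every additively $\mathrm{IP}$ subset of $\mathbb{Z}^d$. In a semigroup $(S,\cdot)$, $B\subseteq S$ is syndetic if there are $s_1,\dots,s_k\in S$ with $S=s_1^{ -1}\cdot B\cup\dots\cup s_k^{ -1}\cdot B$, where $s^{ -1}\cdot B=\{t: s\cdot t\in B\}$. -}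

module Defs where

open import Data.Nat using (ℕ)
open import Data.Integer as ℤ using (ℤ)
open import Data.Vec using (Vec; zipWith; replicate)
open import Data.List using (List; []; _∷_; foldr)
open import Data.List.Relation.Unary.Unique.Propositional using (Unique)
open import Data.Product using (Σ; ∃; _×_; _,_)
open import Data.Sum using (_⊎_)
open import Relation.Binary.PropositionalEquality using (_≡_; _≢_)
open import Relation.Nullary using (¬_)
open import Data.List.Membership.Propositional using (_∈_)
open import Data.List.Relation.Unary.Any using (Any)

ℤ^ : ℕ → Set
ℤ^ d = Vec ℤ d

_⊕_ : ∀ {d} → ℤ^ d → ℤ^ d → ℤ^ d
_⊕_ = zipWith ℤ._+_

𝟘 : ∀ {d} → ℤ^ d
𝟘 = replicate _ (ℤ.+ 0)

Subset : ℕ → Set₁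
Subset d = ℤ^ d → Set

record ProperMultiplication (d : ℕ) (_⊛_ : ℤ^ d → ℤ^ d → ℤ^ d) : Set where
  field
    ⊛-assoc   : ∀ x y z → (x ⊛ y) ⊛ z ≡ x ⊛ (y ⊛ z)
    ⊛-distribˡ : ∀ x y z → x ⊛ (y ⊕ z) ≡ (x ⊛ y) ⊕ (x ⊛ z)
    ⊛-distribʳ : ∀ x y z → (y ⊕ z) ⊛ x ≡ (y ⊛ x) ⊕ (z ⊛ x)
    no-zero-divisors : ∀ x y → x ≢ 𝟘 → y ≢ 𝟘 → (x ⊛ y) ≢ 𝟘

-- finite non-empty subsets of ℕ, given as non-empty duplicate-free lists
record FinNonEmpty : Set where
  constructor fne
  field
    elems    : List ℕ
    nonempty : elems ≢ []
    unique   : Unique elems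

sumOver : ∀ {d} → (ℕ → ℤ^ d) → List ℕ → ℤ^ d
sumOver x = foldr (λ i acc → x i ⊕ acc) 𝟘

IsIP : ∀ {d} → Subset d → Set
IsIP {d} B = Σ (ℕ → ℤ^ d) λ x → ∀ (I : FinNonEmpty) → B (sumOver x (FinNonEmpty.elems I))

IsIPStar : ∀ {d} → Subset d → Set₁
IsIPStar {d} A = ∀ (B : Subset d) → IsIP B → Σ (ℤ^ d) λ b → B b × A b

NonZeroVec : ℕ → Set
NonZeroVec d = Σ (ℤ^ d) λ v → v ≢ 𝟘

-- B ⊆ ℤ^d is syndetic in (ℤ^d_{≠0}, ⊛): there are s₁,…,s_k ∈ ℤ^d_{≠0}
-- with ℤ^d_{≠0} = s₁⁻¹B ∪ … ∪ s_k⁻¹B  (for every t ≠ 0, some s_i ⊛ t ∈ B)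
Syndetic : ∀ {d} → (ℤ^ d → ℤ^ d → ℤ^ d) → Subset d → Set
Syndetic {d} _⊛_ B =
  Σ (List (NonZeroVec d)) λ ss →
    (∀ (t : NonZeroVec d) → Any (λ s → B (Σ.proj₁ s ⊛ Σ.proj₁ t)) ss)
  where open Data.Product

_∖𝟘 : ∀ {d} → Subset d → Subset d
(A ∖𝟘) v = A v × v ≢ 𝟘

-- Let A consist of the vectors that are not of the form (m+1)!·w with w ≠ 0 and ‖w‖ ≤ m.
-- A ∖ {0} is not syndetic: given s₁, …, s_k, take t = (n+1)!·e₁ with n ≥ ‖sᵢ ⊛ e₁‖; left
-- distributivity alone gives sᵢ ⊛ t = (n+1)!·(sᵢ ⊛ e₁), which lies outside A.
-- A is IP*: for the IP set generated by x₀, x₁, …, put N = ‖x₀‖. Pigeonholing the partial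
-- sums x₁ + ⋯ + xⱼ modulo (N+1)! yields a block sum y all of whose entries are divisible by
-- (N+1)!. If x₀ + y = (m+1)!·w with ‖w‖ ≤ m, then either m ≥ N, so (N+1)! divides the entries
-- of x₀, which are smaller than (N+1)! in absolute value; or m < N, and the entries of y are
-- bounded by (m+1)!·m + N < (N+1)!. So x₀ = 0 or y = 0, and 0 ∈ A.

module Submission where

open import Defs
open import Data.Nat as ℕ using (ℕ; zero; suc; _≤_; _<_; _≥_; _⊔_; _!; s≤s; NonZero)
import Data.Nat.Properties as ℕP
import Data.Nat.Divisibility as ℕ∣
open import Data.Integer as ℤ using (ℤ; +_; +0; +[1+_]; -[1+_]; 0ℤ; 1ℤ)
import Data.Integer.Properties as ℤP
import Data.Integer.Divisibility.Signed as ℤ∣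
open ℤ∣ using () renaming (_∣_ to _∣ℤ_)
open import Data.Integer.DivMod using (_%ℕ_; _/ℕ_; n%ℕd<d; a≡a%ℕn+[a/ℕn]*n)
open import Data.Integer.Solver using (module +-*-Solver)
open import Data.Vec using (Vec; []; _∷_; lookup; tabulate)
import Data.Vec.Properties as VP
open import Data.Fin as F using (Fin; toℕ; fromℕ<)
import Data.Fin.Properties as FP
open import Data.List using (List; []; _∷_; _++_; applyUpTo; map)
open import Data.List.Extrema.Nat using (max; xs≤max)
open import Data.List.Relation.Unary.All using (All; []; lookupAny)
open import Data.List.Relation.Unary.All.Properties using (map⁻; applyUpTo⁺₂)
open import Data.List.Relation.Unary.Unique.Propositional using (Unique)
open import Data.List.Relation.Unary.AllPairs using ([]; _∷_)
import Data.List.Relation.Unary.Unique.Propositional.Properties as Unique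
open import Data.Product using (Σ; ∃₂; _×_; _,_; proj₁)
open import Data.Sum using (_⊎_; inj₁; inj₂; [_,_])
open import Function using (_∘_)
open import Relation.Nullary using (¬_; yes; no; contradiction)
open import Relation.Binary.PropositionalEquality hiding ([_])
open import Relation.Binary.Definitions using (DecidableEquality)
open +-*-Solver

lookup-injective : ∀ {a} {A : Set a} {d} {u v : Vec A d} →
                   (∀ k → lookup u k ≡ lookup v k) → u ≡ v
lookup-injective {u = u} {v} eq = begin
  u                 ≡⟨ VP.tabulate∘lookup u ⟨
  tabulate (lookup u) ≡⟨ VP.tabulate-cong eq ⟩
  tabulate (lookup v) ≡⟨ VP.tabulate∘lookup v ⟩
  v                 ∎
  where open ≡-Reasoning

lookup-𝟘 : ∀ {d} (k : Fin d) → lookup 𝟘 k ≡ 0ℤ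
lookup-𝟘 k = VP.lookup-replicate k 0ℤ

lookup-⊕ : ∀ {d} (u v : ℤ^ d) k → lookup (u ⊕ v) k ≡ lookup u k ℤ.+ lookup v k
lookup-⊕ u v k = VP.lookup-zipWith ℤ._+_ k u v

_≟_ : ∀ {d} → DecidableEquality (ℤ^ d)
_≟_ = VP.≡-dec ℤ._≟_

≡𝟘-pointwise : ∀ {d} {v : ℤ^ d} → (∀ k → lookup v k ≡ 0ℤ) → v ≡ 𝟘
≡𝟘-pointwise v≡0 = lookup-injective λ k → trans (v≡0 k) (sym (lookup-𝟘 k))

⊕-identityˡ : ∀ {d} (v : ℤ^ d) → 𝟘 ⊕ v ≡ v
⊕-identityˡ = VP.zipWith-identityˡ ℤP.+-identityˡ

⊕-identityʳ : ∀ {d} (v : ℤ^ d) → v ⊕ 𝟘 ≡ v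
⊕-identityʳ = VP.zipWith-identityʳ ℤP.+-identityʳ

⊕-assoc : ∀ {d} (u v w : ℤ^ d) → (u ⊕ v) ⊕ w ≡ u ⊕ (v ⊕ w)
⊕-assoc = VP.zipWith-assoc ℤP.+-assoc

i≡i+i⇒i≡0 : ∀ {i} → i ≡ i ℤ.+ i → i ≡ 0ℤ
i≡i+i⇒i≡0 {i} i≡i+i = begin
  i               ≡⟨ solve 1 (λ i → i := (i :+ i) :- i) refl i ⟩
  (i ℤ.+ i) ℤ.- i ≡⟨ cong (ℤ._- i) i≡i+i ⟨
  i ℤ.- i         ≡⟨ ℤP.+-inverseʳ i ⟩
  0ℤ              ∎
  where open ≡-Reasoning

v≡v⊕v⇒v≡𝟘 : ∀ {d} {v : ℤ^ d} → v ≡ v ⊕ v → v ≡ 𝟘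
v≡v⊕v⇒v≡𝟘 {v = v} v≡v⊕v = ≡𝟘-pointwise λ k →
  i≡i+i⇒i≡0 (trans (cong (λ u → lookup u k) v≡v⊕v) (lookup-⊕ v v k))

‖_‖ : ∀ {d} → ℤ^ d → ℕ
‖ [] ‖    = 0
‖ i ∷ v ‖ = ℤ.∣ i ∣ ⊔ ‖ v ‖

∣lookup∣≤‖‖ : ∀ {d} (v : ℤ^ d) k → ℤ.∣ lookup v k ∣ ≤ ‖ v ‖
∣lookup∣≤‖‖ (i ∷ v) F.zero    = ℕP.m≤m⊔n ℤ.∣ i ∣ ‖ v ‖
∣lookup∣≤‖‖ (i ∷ v) (F.suc k) = ℕP.m≤n⇒m≤o⊔n ℤ.∣ i ∣ (∣lookup∣≤‖‖ v k)

infixr 25 _·_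

_·_ : ∀ {d} → ℕ → ℤ^ d → ℤ^ d
zero  · v = 𝟘
suc n · v = v ⊕ n · v

lookup-· : ∀ {d} n (v : ℤ^ d) k → lookup (n · v) k ≡ + n ℤ.* lookup v k
lookup-· zero    v k = trans (lookup-𝟘 k) (sym (ℤP.*-zeroˡ (lookup v k)))
lookup-· (suc n) v k = begin
  lookup (v ⊕ n · v) k                ≡⟨ lookup-⊕ v (n · v) k ⟩
  lookup v k ℤ.+ lookup (n · v) k     ≡⟨ cong (λ i → lookup v k ℤ.+ i) (lookup-· n v k) ⟩
  lookup v k ℤ.+ + n ℤ.* lookup v k   ≡⟨ ℤP.suc-* (+ n) (lookup v k) ⟨
  + suc n ℤ.* lookup v k              ∎
  where open ≡-Reasoning

·-≢𝟘 : ∀ {d} n .{{_ : NonZero n}} {v : ℤ^ d} → v ≢ 𝟘 → n · v ≢ 𝟘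
·-≢𝟘 n {v} v≢𝟘 n·v≡𝟘 = v≢𝟘 (≡𝟘-pointwise λ k → ℤP.*-cancelˡ-≡ (+ n) (lookup v k) 0ℤ (begin
  + n ℤ.* lookup v k ≡⟨ lookup-· n v k ⟨
  lookup (n · v) k   ≡⟨ cong (λ u → lookup u k) n·v≡𝟘 ⟩
  lookup 𝟘 k         ≡⟨ lookup-𝟘 k ⟩
  0ℤ                 ≡⟨ ℤP.*-zeroʳ (+ n) ⟨
  + n ℤ.* 0ℤ         ∎))
  where open ≡-Reasoning

⊕≡·⇒lookup : ∀ {d} {u v : ℤ^ d} n w → u ⊕ v ≡ n · w →
             ∀ k → lookup u k ℤ.+ lookup v k ≡ + n ℤ.* lookup w k
⊕≡·⇒lookup {u = u} {v} n w u⊕v≡n·w k = begin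
  lookup u k ℤ.+ lookup v k ≡⟨ lookup-⊕ u v k ⟨
  lookup (u ⊕ v) k          ≡⟨ cong (λ x → lookup x k) u⊕v≡n·w ⟩
  lookup (n · w) k          ≡⟨ lookup-· n w k ⟩
  + n ℤ.* lookup w k        ∎
  where open ≡-Reasoning

module LeftDistributive {d} (_⊛_ : ℤ^ d → ℤ^ d → ℤ^ d)
  (⊛-distribˡ : ∀ x y z → x ⊛ (y ⊕ z) ≡ (x ⊛ y) ⊕ (x ⊛ z)) where

  ⊛-zeroʳ : ∀ s → s ⊛ 𝟘 ≡ 𝟘
  ⊛-zeroʳ s = v≡v⊕v⇒v≡𝟘 (trans (cong (s ⊛_) (sym (⊕-identityˡ 𝟘))) (⊛-distribˡ s 𝟘 𝟘))

  ⊛-·ʳ : ∀ s n v → s ⊛ (n · v) ≡ n · (s ⊛ v)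
  ⊛-·ʳ s zero    v = ⊛-zeroʳ s
  ⊛-·ʳ s (suc n) v = trans (⊛-distribˡ s v (n · v)) (cong ((s ⊛ v) ⊕_) (⊛-·ʳ s n v))

applyUpTo-++ : ∀ {a} {A : Set a} (f : ℕ → A) m n →
               applyUpTo f (m ℕ.+ n) ≡ applyUpTo f m ++ applyUpTo (f ∘ (m ℕ.+_)) n
applyUpTo-++ f zero    n = refl
applyUpTo-++ f (suc m) n = cong (f 0 ∷_) (applyUpTo-++ (f ∘ suc) m n)

sumOver-++ : ∀ {d} (x : ℕ → ℤ^ d) is js → sumOver x (is ++ js) ≡ sumOver x is ⊕ sumOver x js
sumOver-++ x []       js = sym (⊕-identityˡ (sumOver x js))
sumOver-++ x (i ∷ is) js = begin
  x i ⊕ sumOver x (is ++ js)               ≡⟨ cong (x i ⊕_) (sumOver-++ x is js) ⟩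
  x i ⊕ (sumOver x is ⊕ sumOver x js)      ≡⟨ ⊕-assoc (x i) (sumOver x is) (sumOver x js) ⟨
  (x i ⊕ sumOver x is) ⊕ sumOver x js      ∎
  where open ≡-Reasoning

module Residues (M : ℕ) .{{_ : NonZero M}} where

  residue : ℤ → Fin M
  residue i = fromℕ< (n%ℕd<d i M)

  residues : ∀ {d} → ℤ^ d → Fin (M ℕ.^ d)
  residues []      = F.zero
  residues (i ∷ v) = F.combine (residue i) (residues v)

  residues-injective : ∀ {d} (u v : ℤ^ d) → residues u ≡ residues v →
                       ∀ k → lookup u k %ℕ M ≡ lookup v k %ℕ M
  residues-injective (i ∷ u) (j ∷ v) eq F.zero =
    FP.fromℕ<-injective _ _ _ _ (FP.combine-injectiveˡ (residue i) (residues u) (residue j) (residues v) eq)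
  residues-injective (i ∷ u) (j ∷ v) eq (F.suc k) =
    residues-injective u v (FP.combine-injectiveʳ (residue i) (residues u) (residue j) (residues v) eq) k

  %ℕ-≡⇒∣- : ∀ {i j} → i %ℕ M ≡ j %ℕ M → + M ∣ℤ (j ℤ.- i)
  %ℕ-≡⇒∣- {i} {j} eq = ℤ∣.divides (j /ℕ M ℤ.- i /ℕ M) (begin
    j ℤ.- i
      ≡⟨ cong₂ ℤ._-_ (a≡a%ℕn+[a/ℕn]*n j M) (a≡a%ℕn+[a/ℕn]*n i M) ⟩
    (+ (j %ℕ M) ℤ.+ j /ℕ M ℤ.* + M) ℤ.- (+ (i %ℕ M) ℤ.+ i /ℕ M ℤ.* + M)
      ≡⟨ cong (λ r → (+ (j %ℕ M) ℤ.+ j /ℕ M ℤ.* + M) ℤ.- (+ r ℤ.+ i /ℕ M ℤ.* + M)) eq ⟩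
    (+ (j %ℕ M) ℤ.+ j /ℕ M ℤ.* + M) ℤ.- (+ (j %ℕ M) ℤ.+ i /ℕ M ℤ.* + M)
      ≡⟨ solve 4 (λ r p q m → (r :+ p :* m) :- (r :+ q :* m) := (p :- q) :* m) refl
               (+ (j %ℕ M)) (j /ℕ M) (i /ℕ M) (+ M) ⟩
    (j /ℕ M ℤ.- i /ℕ M) ℤ.* + M ∎)
    where open ≡-Reasoning

  pigeonhole-mod : ∀ {d} (Q : ℕ → ℤ^ d) →
                   ∃₂ λ i j → i < j × ∀ k → + M ∣ℤ (lookup (Q j) k ℤ.- lookup (Q i) k)
  pigeonhole-mod {d} Q with FP.pigeonhole (ℕP.n<1+n (M ℕ.^ d)) (residues ∘ Q ∘ toℕ)
  ... | i , j , i<j , eq = toℕ i , toℕ j , i<j , λ k →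
    %ℕ-≡⇒∣- {lookup (Q (toℕ i)) k} {lookup (Q (toℕ j)) k}
      (residues-injective (Q (toℕ i)) (Q (toℕ j)) eq k)

-- Opaque so that unification never unfolds (1+n)! into the sum n ! + n * n !.
opaque
  [1+_]! : ℕ → ℕ
  [1+ n ]! = suc n !

  instance
    [1+]!-nonZero : ∀ {n} → NonZero ([1+ n ]!)
    [1+]!-nonZero {n} = suc n ℕP.!≢0

  n<[1+n]! : ∀ n → n < [1+ n ]!
  n<[1+n]! n = ℕP.m≤m*n (suc n) (n !) {{n ℕP.!≢0}}

  [1+]!-mono-∣ : ∀ {m n} → m ≤ n → [1+ m ]! ℕ∣.∣ [1+ n ]!
  [1+]!-mono-∣ m≤n = ℕ∣.m≤n⇒m!∣n! (s≤s m≤n)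

  [1+]!-suc : ∀ n → [1+ suc n ]! ≡ [1+ n ]! ℕ.+ suc n ℕ.* [1+ n ]!
  [1+]!-suc n = refl

[1+]!-mono-≤ : ∀ {m n} → m ≤ n → [1+ m ]! ≤ [1+ n ]!
[1+]!-mono-≤ m≤n = ℕ∣.∣⇒≤ ([1+]!-mono-∣ m≤n)

[1+m]!*m+n<[1+n]! : ∀ {m n} → m < n → [1+ m ]! ℕ.* m ℕ.+ n < [1+ n ]!
[1+m]!*m+n<[1+n]! {m} {suc n} (s≤s m≤n) = begin-strict
  [1+ m ]! ℕ.* m ℕ.+ suc n          ≤⟨ ℕP.+-monoˡ-≤ (suc n) (ℕP.*-mono-≤ ([1+]!-mono-≤ m≤n) m≤n) ⟩
  [1+ n ]! ℕ.* n ℕ.+ suc n          ≤⟨ ℕP.+-monoʳ-≤ ([1+ n ]! ℕ.* n) (n<[1+n]! n) ⟩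
  [1+ n ]! ℕ.* n ℕ.+ [1+ n ]!       ≡⟨ ℕP.+-comm ([1+ n ]! ℕ.* n) [1+ n ]! ⟩
  [1+ n ]! ℕ.+ [1+ n ]! ℕ.* n       ≡⟨ cong ([1+ n ]! ℕ.+_) (ℕP.*-comm [1+ n ]! n) ⟩
  [1+ n ]! ℕ.+ n ℕ.* [1+ n ]!       <⟨ ℕP.+-monoʳ-< [1+ n ]! (ℕP.m<n+m _ (ℕ.>-nonZero⁻¹ [1+ n ]!)) ⟩
  [1+ n ]! ℕ.+ suc n ℕ.* [1+ n ]!   ≡⟨ [1+]!-suc n ⟨
  [1+ suc n ]!                      ∎
  where open ℕP.≤-Reasoning

FactorialMultiple : ∀ {d} → Subset d
FactorialMultiple {d} v = v ≢ 𝟘 × ∃₂ λ m (w : ℤ^ d) → ‖ w ‖ ≤ m × v ≡ [1+ m ]! · w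

NotFactorialMultiple : ∀ {d} → Subset d
NotFactorialMultiple v = ¬ FactorialMultiple v

≡𝟘⇒notFactorialMultiple : ∀ {d} {v : ℤ^ d} → v ≡ 𝟘 → NotFactorialMultiple v
≡𝟘⇒notFactorialMultiple v≡𝟘 (v≢𝟘 , _) = v≢𝟘 v≡𝟘

n∣i∧∣i∣<n⇒i≡0 : ∀ {n i} → + n ∣ℤ i → ℤ.∣ i ∣ < n → i ≡ 0ℤ
n∣i∧∣i∣<n⇒i≡0 {i = +0}       _   _ = refl
n∣i∧∣i∣<n⇒i≡0 {i = +[1+ _ ]} n∣i i<n = contradiction (ℤ∣.∣⇒∣ᵤ n∣i) (ℕ∣.>⇒∤ i<n)
n∣i∧∣i∣<n⇒i≡0 {i = -[1+ _ ]} n∣i i<n = contradiction (ℤ∣.∣⇒∣ᵤ n∣i) (ℕ∣.>⇒∤ i<n)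

module _ {m n : ℕ} {a b c : ℤ} (a+b≡[1+m]!*c : a ℤ.+ b ≡ + [1+ m ]! ℤ.* c)
         (∣a∣≤n : ℤ.∣ a ∣ ≤ n) ([1+n]!∣b : + [1+ n ]! ∣ℤ b) where

  n≤m⇒a≡0 : n ≤ m → a ≡ 0ℤ
  n≤m⇒a≡0 n≤m = n∣i∧∣i∣<n⇒i≡0 [1+n]!∣a (ℕP.≤-<-trans ∣a∣≤n (n<[1+n]! n))
    where
    [1+n]!∣a+b : + [1+ n ]! ∣ℤ (a ℤ.+ b)
    [1+n]!∣a+b = subst (+ [1+ n ]! ∣ℤ_) (sym a+b≡[1+m]!*c)
                   (ℤ∣.∣m⇒∣m*n {m = + [1+ m ]!} c (ℤ∣.∣ᵤ⇒∣ ([1+]!-mono-∣ n≤m)))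
    [1+n]!∣a : + [1+ n ]! ∣ℤ a
    [1+n]!∣a = ℤ∣.∣m+n∣n⇒∣m [1+n]!∣a+b [1+n]!∣b

  m<n⇒b≡0 : m < n → ℤ.∣ c ∣ ≤ m → b ≡ 0ℤ
  m<n⇒b≡0 m<n ∣c∣≤m = n∣i∧∣i∣<n⇒i≡0 [1+n]!∣b (begin-strict
    ℤ.∣ b ∣                              ≡⟨ cong ℤ.∣_∣ b≡[1+m]!*c-a ⟩
    ℤ.∣ + [1+ m ]! ℤ.* c ℤ.- a ∣         ≤⟨ ℤP.∣i-j∣≤∣i∣+∣j∣ (+ [1+ m ]! ℤ.* c) a ⟩
    ℤ.∣ + [1+ m ]! ℤ.* c ∣ ℕ.+ ℤ.∣ a ∣   ≡⟨ cong (ℕ._+ ℤ.∣ a ∣) (ℤP.abs-* (+ [1+ m ]!) c) ⟩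
    [1+ m ]! ℕ.* ℤ.∣ c ∣ ℕ.+ ℤ.∣ a ∣     ≤⟨ ℕP.+-mono-≤ (ℕP.*-monoʳ-≤ [1+ m ]! ∣c∣≤m) ∣a∣≤n ⟩
    [1+ m ]! ℕ.* m ℕ.+ n                 <⟨ [1+m]!*m+n<[1+n]! m<n ⟩
    [1+ n ]!                             ∎)
    where
    open ℕP.≤-Reasoning
    b≡[1+m]!*c-a : b ≡ + [1+ m ]! ℤ.* c ℤ.- a
    b≡[1+m]!*c-a = trans (solve 2 (λ a b → b := (a :+ b) :- a) refl a b)
                         (cong (ℤ._- a) a+b≡[1+m]!*c)

factorialMultiple-⊕ : ∀ {d} {u v : ℤ^ d} → (∀ k → + [1+ ‖ u ‖ ]! ∣ℤ lookup v k) →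
                      FactorialMultiple (u ⊕ v) → u ≡ 𝟘 ⊎ v ≡ 𝟘
factorialMultiple-⊕ {u = u} {v} F∣v (_ , m , w , ‖w‖≤m , u⊕v≡[1+m]!·w) with ‖ u ‖ ℕP.≤? m
... | yes ‖u‖≤m = inj₁ (≡𝟘-pointwise λ k →
  n≤m⇒a≡0 (⊕≡·⇒lookup [1+ m ]! w u⊕v≡[1+m]!·w k) (∣lookup∣≤‖‖ u k) (F∣v k) ‖u‖≤m)
... | no ‖u‖≰m  = inj₂ (≡𝟘-pointwise λ k →
  m<n⇒b≡0 {a = lookup u k} (⊕≡·⇒lookup [1+ m ]! w u⊕v≡[1+m]!·w k) (∣lookup∣≤‖‖ u k) (F∣v k)
          (ℕP.≰⇒> ‖u‖≰m) (ℕP.≤-trans (∣lookup∣≤‖‖ w k) ‖w‖≤m))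

block : ℕ → ℕ → List ℕ
block i l = applyUpTo (suc ∘ (i ℕ.+_)) l

block-unique : ∀ i l → Unique (block i l)
block-unique i l = Unique.applyUpTo⁺₁ (suc ∘ (i ℕ.+_)) l
  λ j<k _ → ℕP.<⇒≢ (s≤s (ℕP.+-monoʳ-< i j<k))

0∷block-unique : ∀ i l → Unique (0 ∷ block i l)
0∷block-unique i l = applyUpTo⁺₂ (suc ∘ (i ℕ.+_)) l (λ _ ()) ∷ block-unique i l

module _ {d} (x : ℕ → ℤ^ d) where

  partialSum : ℕ → ℤ^ d
  partialSum n = sumOver x (applyUpTo suc n)

  partialSum-+ : ∀ i l → partialSum (i ℕ.+ l) ≡ partialSum i ⊕ sumOver x (block i l)
  partialSum-+ i l = trans (cong (sumOver x) (applyUpTo-++ suc i l))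
                           (sumOver-++ x (applyUpTo suc i) (block i l))

  divisible-block : ∀ M .{{_ : NonZero M}} →
                    ∃₂ λ i l → ∀ k → + M ∣ℤ lookup (sumOver x (block i (suc l))) k
  divisible-block M with Residues.pigeonhole-mod M partialSum
  ... | i , j , i<j , M∣ with ℕP.m≤n⇒∃[o]m+o≡n i<j
  ... | l , refl = i , l , λ k → subst (+ M ∣ℤ_) (y≡ k) (M∣ k)
    where
    y = sumOver x (block i (suc l))
    y≡ : ∀ k → lookup (partialSum (suc i ℕ.+ l)) k ℤ.- lookup (partialSum i) k ≡ lookup y k
    y≡ k = begin
      lookup (partialSum (suc i ℕ.+ l)) k ℤ.- lookup (partialSum i) k
        ≡⟨ cong (λ n → lookup (partialSum n) k ℤ.- lookup (partialSum i) k) (ℕP.+-suc i l) ⟨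
      lookup (partialSum (i ℕ.+ suc l)) k ℤ.- lookup (partialSum i) k
        ≡⟨ cong (λ v → lookup v k ℤ.- lookup (partialSum i) k) (partialSum-+ i (suc l)) ⟩
      lookup (partialSum i ⊕ y) k ℤ.- lookup (partialSum i) k
        ≡⟨ cong (ℤ._- lookup (partialSum i) k) (lookup-⊕ (partialSum i) y k) ⟩
      (lookup (partialSum i) k ℤ.+ lookup y k) ℤ.- lookup (partialSum i) k
        ≡⟨ solve 2 (λ p q → (p :+ q) :- p := q) refl (lookup (partialSum i) k) (lookup y k) ⟩
      lookup y k ∎
      where open ≡-Reasoning

notFactorialMultiple-isIPStar : ∀ {d} → IsIPStar (NotFactorialMultiple {d})
notFactorialMultiple-isIPStar B (x , FS[x]⊆B) with divisible-block x ([1+ ‖ x 0 ‖ ]!)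
... | i , l , F∣y with x 0 ≟ 𝟘 | sumOver x (block i (suc l)) ≟ 𝟘
... | yes x₀≡𝟘 | _ =
  _ , FS[x]⊆B (fne (0 ∷ []) (λ ()) ([] ∷ [])) ,
  ≡𝟘⇒notFactorialMultiple (trans (⊕-identityʳ (x 0)) x₀≡𝟘)
... | no _ | yes y≡𝟘 =
  _ , FS[x]⊆B (fne (block i (suc l)) (λ ()) (block-unique i (suc l))) , ≡𝟘⇒notFactorialMultiple y≡𝟘
... | no x₀≢𝟘 | no y≢𝟘 =
  _ , FS[x]⊆B (fne (0 ∷ block i (suc l)) (λ ()) (0∷block-unique i (suc l))) ,
  [ x₀≢𝟘 , y≢𝟘 ] ∘ factorialMultiple-⊕ F∣y

module _ {d} (_⊛_ : ℤ^ d → ℤ^ d → ℤ^ d)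
  (⊛-distribˡ : ∀ x y z → x ⊛ (y ⊕ z) ≡ (x ⊛ y) ⊕ (x ⊛ z)) where
  open LeftDistributive _⊛_ ⊛-distribˡ

  notFactorialMultiple∖𝟘-¬syndetic : {u : ℤ^ d} → u ≢ 𝟘 → ¬ Syndetic _⊛_ (NotFactorialMultiple ∖𝟘)
  notFactorialMultiple∖𝟘-¬syndetic {u} u≢𝟘 (ss , cover)
    with lookupAny bounded (cover ([1+ n ]! · u , ·-≢𝟘 ([1+ n ]!) u≢𝟘))
    where
    n = max 0 (map (λ s → ‖ proj₁ s ⊛ u ‖) ss)
    bounded : All (λ s → ‖ proj₁ s ⊛ u ‖ ≤ n) ss
    bounded = map⁻ (xs≤max 0 (map (λ s → ‖ proj₁ s ⊛ u ‖) ss))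
  ... | ‖s⊛u‖≤n , notFM , s⊛t≢𝟘 = notFM (s⊛t≢𝟘 , _ , _ , ‖s⊛u‖≤n , ⊛-·ʳ _ ([1+ _ ]!) u)

e₁ : ∀ {d} → ℤ^ (suc d)
e₁ = 1ℤ ∷ 𝟘

theorem5p12 : (d : ℕ) → d ≥ 1 →
    Σ (Subset d) λ A →
      IsIPStar A ×
      (∀ (_⊛_ : ℤ^ d → ℤ^ d → ℤ^ d) → ProperMultiplication d _⊛_ →
        ¬ Syndetic _⊛_ (A ∖𝟘))
theorem5p12 (suc d) _ =
  NotFactorialMultiple ,
  notFactorialMultiple-isIPStar ,
  λ _⊛_ isProper →
    notFactorialMultiple∖𝟘-¬syndetic _⊛_ (ProperMultiplication.⊛-distribˡ isProper) {e₁} (λ ())
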